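{- For all integers $n,p\ge 1$, the Sierpiński graph $S_p^n$ satisfies $$\gamma_{gr}(S_p^n)=p^{n-1}+\frac{p\,(p^{n-1}-1)}{2}.$$
   Context: Let $[p]_0=\{0,1,\ldots,p-1\}$ and $[n]=\{1,\ldots,n\}$. The Sierpiński graph $S_p^n$ has vertex set $[p]_0^n$, and two distinct vertices $u=(u_1,\ldots,u_n)$, $v=(v_1,\ldots,v_n)$ are adjacent if and only if there exists $h\in[n]$ such that $u_t=v_t$ for $t<h$, $u_h\neq v_h$, and $u_t=v_h$ and $v_t=u_h$ for all $t=h+1,\ldots,n$. For a vertex $v$, $N[v]$ denotes its closed neighborhood. A sequence $(v_1,\ldots,v_k)$ of distinct vertices of a graph $G$ is legal if $N[v_i]\setminus\bigcup_{j<i}N[v_j]\neq\emptyset$ for every $i$, and dominating if moreover $\{v_1,\ldots,v_k\}$ dominates $G$. The Grundy domination number $\gamma_{gr}(G)$ is the maximum length of a legal dominating sequence of $G$. -}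

module Defs where

open import Data.Nat using (ℕ; _<_)
open import Data.Fin using (Fin; toℕ)
open import Data.Vec using (Vec; lookup)
open import Data.List using (List; length)
import Data.List as L
open import Data.List.Relation.Unary.Any using (Any)
open import Data.List.Relation.Unary.Unique.Propositional using (Unique)
open import Data.Product using (Σ; ∃; _×_)
open import Data.Sum using (_⊎_)
open import Relation.Binary.PropositionalEquality using (_≡_; _≢_)
open import Relation.Nullary using (¬_)

-- Vertices of the Sierpiński graph S_p^n: words of length n over [p]_0 = Fin p.
-- Coordinate t ∈ [n] corresponds to index (t-1) : Fin n.
SVertex : ℕ → ℕ → Set
SVertex p n = Vec (Fin p) n

SAdj : (p n : ℕ) → SVertex p n → SVertex p n → Set
SAdj p n u v =
  ∃ λ (h : Fin n) →
    (∀ (t : Fin n) → toℕ t < toℕ h → lookup u t ≡ lookup v t)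
    × lookup u h ≢ lookup v h
    × (∀ (t : Fin n) → toℕ h < toℕ t →
         (lookup u t ≡ lookup v h) × (lookup v t ≡ lookup u h))

InClosedNbhd : (p n : ℕ) → SVertex p n → SVertex p n → Set
InClosedNbhd p n v w = (w ≡ v) ⊎ SAdj p n v w

Legal : (p n : ℕ) → List (SVertex p n) → Set
Legal p n s =
  Unique s ×
  (∀ (i : Fin (length s)) → ∃ λ (w : SVertex p n) →
      InClosedNbhd p n (L.lookup s i) w ×
      (∀ (j : Fin (length s)) → toℕ j < toℕ i →
         ¬ InClosedNbhd p n (L.lookup s j) w))

Dominating : (p n : ℕ) → List (SVertex p n) → Set
Dominating p n s = ∀ (w : SVertex p n) → Any (λ v → InClosedNbhd p n v w) s

LegalDominating : (p n : ℕ) → List (SVertex p n) → Set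
LegalDominating p n s = Legal p n s × Dominating p n s

IsGrundyDominationNumber : (p n : ℕ) → ℕ → Set
IsGrundyDominationNumber p n k =
  (∃ λ (s : List (SVertex p n)) → LegalDominating p n s × length s ≡ k)
  × (∀ (s : List (SVertex p n)) → LegalDominating p n s → length s Data.Nat.≤ k)

-- The closed neighbourhoods of S_p^(m+1) are covered by cliques p m cliques: the p^m
-- copies of K_p (words with a common prefix of length m) and the bridge edges
-- {w j k^r, w k j^r} with j < k.  In a legal sequence the
-- clique through v_i and its footprint contains no earlier v_j (the footprint would lie in
-- N[v_j]), so no legal sequence is longer than that.  One of exactly that length is built
-- letter by letter: for j = 0, …, p-1 run a sequence in the copy with first letter j, then
-- the bridge vertices j k^m with k > j, whose footprints k j^m are still undominated.
-- A legal sequence of maximum length dominates, since an undominated vertex could be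
-- appended to it.  Finally cliques p m = p^m + p (p^m - 1) / 2.

module Submission where

open import Defs
open import Level using (0ℓ)
open import Function using (_∘_; Injective)
open import Function.Bundles using (_↣_; mk↣; Injection)
open import Function.Construct.Identity using (↣-id)
open import Function.Construct.Composition using (_↣-∘_)
open import Function.Properties.Inverse using (↔⇒↣; ↔-sym)
open import Data.Product.Function.NonDependent.Propositional using (_×-↣_)
open import Data.Sum.Function.Propositional using (_⊎-↣_)
open import Data.Nat using (ℕ; zero; suc; _≤_; _<_; _+_; _*_; _∸_; _^_; _/_; _⊔_; _⊓_; z≤n; s≤s)
import Data.Nat.Properties as ℕ
import Data.Nat.DivMod as DivMod
open import Data.Fin using (Fin; toℕ; fromℕ<) renaming (zero to fzero; suc to fsuc)
import Data.Fin.Properties as Fin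
open import Data.Vec using ([]; _∷_; head; tail; lookup; replicate)
import Data.Vec.Properties as Vec
open import Data.List as List using (List; []; _∷_; _++_; [_]; length; map; concat; tabulate)
import Data.List.Properties as List
open import Data.List.Relation.Unary.Any using (Any; here; there; any?)
import Data.List.Relation.Unary.Any.Properties as Any
open import Data.List.Relation.Unary.All as All using (All; []; _∷_)
import Data.List.Relation.Unary.All.Properties as All
open import Data.List.Relation.Unary.AllPairs as AllPairs using (AllPairs; []; _∷_)
import Data.List.Relation.Unary.AllPairs.Properties as AllPairs
open import Data.Product using (Σ; ∃; _×_; _,_; proj₁; proj₂)
open import Data.Sum using (_⊎_; inj₁; inj₂)
import Data.Sum as Sum
open import Data.Empty using (⊥-elim)
open import Data.Unit using (⊤; tt)
open import Relation.Binary.Definitions using (tri<; tri≈; tri>)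
open import Relation.Binary.PropositionalEquality
  using (_≡_; _≢_; refl; sym; trans; cong; cong₂; subst; module ≡-Reasoning)
open import Data.Nat.Tactic.RingSolver using (solve-∀)
open import Relation.Nullary using (Dec; yes; no; ¬?; _×-dec_; _⊎-dec_; _→-dec_)
open import Relation.Unary using (Pred; _∈_; _∉_; _∪_; _∩_; _⊆_; ∁; ∅; Satisfiable)

pairs : ℕ → ℕ
pairs zero = 0
pairs (suc q) = q + pairs q

Bridge : ℕ → Set
Bridge q = Σ (Fin q) λ j → Σ (Fin q) λ k → toℕ j < toℕ k

peel : ∀ {q} → Bridge (suc q) → Fin q ⊎ Bridge q
peel (fzero , fsuc k , _) = inj₁ k
peel (fsuc j , fsuc k , s≤s j<k) = inj₂ (j , k , j<k)

peel-injective : ∀ {q} → Injective _≡_ _≡_ (peel {q})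
peel-injective {x = fzero , fsuc k , s≤s z≤n} {fzero , fsuc k , s≤s z≤n} refl = refl
peel-injective {x = fsuc j , fsuc k , s≤s _} {fsuc j , fsuc k , s≤s _} refl = refl
peel-injective {x = fzero , fsuc k , s≤s z≤n} {fsuc j , fsuc k′ , s≤s _} ()
peel-injective {x = fsuc j , fsuc k , s≤s _} {fzero , fsuc k′ , s≤s z≤n} ()

bridge↣ : ∀ q → Bridge q ↣ Fin (pairs q)
bridge↣ zero = mk↣ {to = λ ()} λ { {() , _} }
bridge↣ (suc q) =
  ↔⇒↣ (↔-sym Fin.+↔⊎) ↣-∘ ((↣-id _ ⊎-↣ bridge↣ q) ↣-∘ mk↣ peel-injective)

cliques : ℕ → ℕ → ℕ
cliques p zero = 1
cliques p (suc m) = p * cliques p m + pairs p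

greaterThan : ∀ {q} → Fin q → List (Fin q)
greaterThan {suc q} fzero = tabulate fsuc
greaterThan {suc q} (fsuc j) = map fsuc (greaterThan j)

greaterThan-above : ∀ {q} (j : Fin q) → All (λ k → toℕ j < toℕ k) (greaterThan j)
greaterThan-above fzero = All.tabulate⁺ (λ _ → s≤s z≤n)
greaterThan-above (fsuc j) = All.map⁺ (All.map s≤s (greaterThan-above j))

greaterThan-distinct : ∀ {q} (j : Fin q) →
  AllPairs (λ k k′ → k ≢ k′ × toℕ j < toℕ k′) (greaterThan j)
greaterThan-distinct fzero = AllPairs.tabulate⁺ (λ i≢j → i≢j ∘ Fin.suc-injective , s≤s z≤n)
greaterThan-distinct (fsuc j) =
  AllPairs.map⁺ (AllPairs.map (λ (k≢k′ , j<k′) → k≢k′ ∘ Fin.suc-injective , s≤s j<k′)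
                              (greaterThan-distinct j))

length-concat-blocks : ∀ {A : Set} {q} a (block : Fin q → List A) →
  (∀ j → length (block j) ≡ a + length (greaterThan j)) →
  length (concat (tabulate block)) ≡ q * a + pairs q
length-concat-blocks {q = zero} a block _ = refl
length-concat-blocks {q = suc q} a block length-block = begin
  length (block fzero ++ concat (tabulate (block ∘ fsuc)))
    ≡⟨ List.length-++ (block fzero) ⟩
  length (block fzero) + length (concat (tabulate (block ∘ fsuc)))
    ≡⟨ cong₂ _+_ (trans (length-block fzero) (cong (a +_) (List.length-tabulate fsuc)))
                 (length-concat-blocks a (block ∘ fsuc) length-rest) ⟩
  (a + q) + (q * a + pairs q)
    ≡⟨ shuffle a q (pairs q) ⟩
  suc q * a + pairs (suc q) ∎
  where
  open ≡-Reasoning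
  length-rest : ∀ j → length (block (fsuc j)) ≡ a + length (greaterThan j)
  length-rest j = trans (length-block (fsuc j)) (cong (a +_) (List.length-map fsuc (greaterThan j)))
  shuffle : ∀ a q r → (a + q) + (q * a + r) ≡ (a + q * a) + (q + r)
  shuffle = solve-∀

-- clamp j t = if j < t then j + 1 else j
clamp : ℕ → ℕ → ℕ
clamp j t = j ⊔ (suc j ⊓ t)

clamp-≥ : ∀ j t → j ≤ clamp j t
clamp-≥ j t = ℕ.m≤m⊔n j _

clamp-≤ : ∀ j t → clamp j t ≤ suc j
clamp-≤ j t = ℕ.⊔-lub (ℕ.n≤1+n j) (ℕ.m⊓n≤m (suc j) t)

clamp-≤-self : ∀ {j t} → t ≤ j → clamp j t ≤ j
clamp-≤-self {j} t≤j = ℕ.⊔-lub ℕ.≤-refl (ℕ.≤-trans (ℕ.m⊓n≤n (suc j) _) t≤j)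

<⇒<clamp : ∀ {j t} → j < t → j < clamp j t
<⇒<clamp {j} j<t = ℕ.≤-trans (ℕ.⊓-glb ℕ.≤-refl j<t) (ℕ.m≤n⊔m j _)

clamp-positive : ∀ j {t} → 0 < t → 0 < clamp j t
clamp-positive zero = <⇒<clamp
clamp-positive (suc j) {t} _ = ℕ.<-≤-trans (s≤s z≤n) (clamp-≥ (suc j) t)

clamp-< : ∀ {j t q} → j < q → t < q → clamp j t < q
clamp-< {j} j<q t<q = ℕ.⊔-pres-<m j<q (ℕ.≤-<-trans (ℕ.m⊓n≤n (suc j) _) t<q)

module _ {p : ℕ} where

  Vertex : ℕ → Set
  Vertex = SVertex p

  extreme : ∀ n → Fin p → Vertex n
  extreme n e = replicate n e

  N[_] : ∀ {n} → Vertex n → Pred (Vertex n) 0ℓ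
  N[ v ] w = InClosedNbhd p _ v w

  Dominated : ∀ {n} → List (Vertex n) → Pred (Vertex n) 0ℓ
  Dominated s w = Any (λ v → w ∈ N[ v ]) s

  extreme-injective : ∀ {n a b} → extreme (suc n) a ≡ extreme (suc n) b → a ≡ b
  extreme-injective refl = refl

  ≡extreme : ∀ {n} {u : Vertex n} {b} → (∀ t → lookup u t ≡ b) → u ≡ extreme n b
  ≡extreme {u = []} _ = refl
  ≡extreme {u = _ ∷ _} u≡b = cong₂ _∷_ (u≡b fzero) (≡extreme (u≡b ∘ fsuc))

  SAdj-∷⁻ : ∀ {n a} {u v : Vertex n} → SAdj p (suc n) (a ∷ u) (a ∷ v) → SAdj p n u v
  SAdj-∷⁻ (fzero , _ , a≢a , _) = ⊥-elim (a≢a refl)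
  SAdj-∷⁻ (fsuc h , before , u≢v , after) =
    h , (λ t t<h → before (fsuc t) (s≤s t<h)) , u≢v , (λ t h<t → after (fsuc t) (s≤s h<t))

  SAdj-∷⁺ : ∀ {n} a {u v : Vertex n} → SAdj p n u v → SAdj p (suc n) (a ∷ u) (a ∷ v)
  SAdj-∷⁺ a {u} {v} (h , before , u≢v , after) = fsuc h , before′ , u≢v , after′
    where
    before′ : ∀ t → toℕ t < suc (toℕ h) → lookup (a ∷ u) t ≡ lookup (a ∷ v) t
    before′ fzero _ = refl
    before′ (fsuc t) (s≤s t<h) = before t t<h
    after′ : ∀ t → suc (toℕ h) < toℕ t →
             lookup (a ∷ u) t ≡ lookup v h × lookup (a ∷ v) t ≡ lookup u h
    after′ (fsuc t) (s≤s h<t) = after t h<t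

  SAdj-bridge⁻ : ∀ {n a b} {u v : Vertex n} → a ≢ b → SAdj p (suc n) (a ∷ u) (b ∷ v) →
                 u ≡ extreme n b × v ≡ extreme n a
  SAdj-bridge⁻ _ (fzero , _ , _ , after) =
    ≡extreme (λ t → proj₁ (after (fsuc t) (s≤s z≤n))) ,
    ≡extreme (λ t → proj₂ (after (fsuc t) (s≤s z≤n)))
  SAdj-bridge⁻ a≢b (fsuc _ , before , _ , _) = ⊥-elim (a≢b (before fzero (s≤s z≤n)))

  SAdj-bridge⁺ : ∀ {n a b} → a ≢ b → SAdj p (suc n) (a ∷ extreme n b) (b ∷ extreme n a)
  SAdj-bridge⁺ {n} {a} {b} a≢b = fzero , (λ _ ()) , a≢b , after
    where
    after : ∀ t → 0 < toℕ t → lookup (a ∷ extreme n b) t ≡ b × lookup (b ∷ extreme n a) t ≡ a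
    after (fsuc t) _ = Vec.lookup-replicate t b , Vec.lookup-replicate t a

  ∈N-∷⁻ : ∀ {n a} {u w : Vertex n} → a ∷ w ∈ N[ a ∷ u ] → w ∈ N[ u ]
  ∈N-∷⁻ (inj₁ refl) = inj₁ refl
  ∈N-∷⁻ (inj₂ adj) = inj₂ (SAdj-∷⁻ adj)

  ∈N-∷⁺ : ∀ {n} a {u w : Vertex n} → w ∈ N[ u ] → a ∷ w ∈ N[ a ∷ u ]
  ∈N-∷⁺ a (inj₁ refl) = inj₁ refl
  ∈N-∷⁺ a (inj₂ adj) = inj₂ (SAdj-∷⁺ a adj)

  ∈N-bridge⁻ : ∀ {n a b} {u w : Vertex n} → a ≢ b → b ∷ w ∈ N[ a ∷ u ] →
               u ≡ extreme n b × w ≡ extreme n a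
  ∈N-bridge⁻ a≢b (inj₁ refl) = ⊥-elim (a≢b refl)
  ∈N-bridge⁻ a≢b (inj₂ adj) = SAdj-bridge⁻ a≢b adj

  ∈N-bridge⁺ : ∀ {n a b} → a ≢ b → b ∷ extreme n a ∈ N[ a ∷ extreme n b ]
  ∈N-bridge⁺ a≢b = inj₂ (SAdj-bridge⁺ a≢b)

  ∈N-head : ∀ {n} {v : Vertex (suc n)} w → w ∈ N[ v ] →
            head w ≡ head v ⊎ tail w ≡ extreme n (head v)
  ∈N-head {v = a ∷ _} (b ∷ w) w∈N with b Fin.≟ a
  ... | yes b≡a = inj₁ b≡a
  ... | no b≢a = inj₂ (proj₂ (∈N-bridge⁻ (b≢a ∘ sym) w∈N))

  ∈N-complete : (a b : Fin p) → b ∷ [] ∈ N[ a ∷ [] ]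
  ∈N-complete a b with a Fin.≟ b
  ... | yes refl = inj₁ refl
  ... | no a≢b = ∈N-bridge⁺ a≢b

  ∈N? : ∀ {n} (v w : Vertex n) → Dec (w ∈ N[ v ])
  ∈N? v w = Vec.≡-dec Fin._≟_ w v ⊎-dec
    Fin.any? λ h → Fin.all? (λ t → (toℕ t ℕ.<? toℕ h) →-dec (lookup v t Fin.≟ lookup w t))
             ×-dec ¬? (lookup v h Fin.≟ lookup w h)
             ×-dec Fin.all? (λ t → (toℕ h ℕ.<? toℕ t) →-dec
                                   ((lookup v t Fin.≟ lookup w h) ×-dec (lookup w t Fin.≟ lookup v h)))

  LegalAfter : ∀ {n} → Pred (Vertex n) 0ℓ → List (Vertex n) → Set
  LegalAfter D [] = ⊤
  LegalAfter D (v ∷ s) = Satisfiable (N[ v ] ∩ ∁ D) × LegalAfter (D ∪ N[ v ]) s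

  LegalAfter-antitone : ∀ {n} {D D′ : Pred (Vertex n) 0ℓ} s → D′ ⊆ D →
                        LegalAfter D s → LegalAfter D′ s
  LegalAfter-antitone [] _ _ = tt
  LegalAfter-antitone (v ∷ s) D′⊆D ((w , w∈N , w∉D) , rest) =
    (w , w∈N , w∉D ∘ D′⊆D) , LegalAfter-antitone s (Sum.map₁ D′⊆D) rest

  LegalAfter-++ : ∀ {n} {D : Pred (Vertex n) 0ℓ} s t → LegalAfter D s →
                  LegalAfter (D ∪ Dominated s) t → LegalAfter D (s ++ t)
  LegalAfter-++ [] t _ legal-t = LegalAfter-antitone t inj₁ legal-t
  LegalAfter-++ {D = D} (v ∷ s) t (fp , legal-s) legal-t =
    fp , LegalAfter-++ s t legal-s (LegalAfter-antitone t regroup legal-t)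
    where
    regroup : (D ∪ N[ v ]) ∪ Dominated s ⊆ D ∪ Dominated (v ∷ s)
    regroup (inj₁ (inj₁ w∈D)) = inj₁ w∈D
    regroup (inj₁ (inj₂ w∈N)) = inj₂ (here w∈N)
    regroup (inj₂ w∈Ns) = inj₂ (there w∈Ns)

  LegalAfter-map-∷ : ∀ {n} {D : Pred (Vertex (suc n)) 0ℓ} {E : Pred (Vertex n) 0ℓ} a s →
                     (∀ {u} → a ∷ u ∈ D → u ∈ E) →
                     LegalAfter E s → LegalAfter D (map (a ∷_) s)
  LegalAfter-map-∷ a [] _ _ = tt
  LegalAfter-map-∷ a (v ∷ s) D⇒E ((w , w∈N , w∉E) , rest) =
    (a ∷ w , ∈N-∷⁺ a w∈N , w∉E ∘ D⇒E) ,
    LegalAfter-map-∷ a s (Sum.map D⇒E ∈N-∷⁻) rest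

  LegalAfter-footprints : ∀ {n} {X : Set} {D : Pred (Vertex n) 0ℓ}
                          (vertex footprint : X → Vertex n) {xs} →
    All (λ x → footprint x ∈ N[ vertex x ] ∩ ∁ D) xs →
    AllPairs (λ x y → footprint y ∉ N[ vertex x ]) xs →
    LegalAfter D (map vertex xs)
  LegalAfter-footprints vertex footprint [] [] = tt
  LegalAfter-footprints vertex footprint {x ∷ _} (fx ∷ fxs) (x-misses ∷ later) =
    (footprint x , fx) ,
    LegalAfter-footprints vertex footprint
      (All.zipWith (λ ((y∈N , y∉D) , x-misses-y) → y∈N , Sum.[ y∉D , x-misses-y ])
                   (fxs , x-misses))
      later

  LegalAfter-concat : ∀ {n q} (B : ℕ → Pred (Vertex n) 0ℓ) (block : Fin q → List (Vertex n)) →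
    (∀ j → LegalAfter (B (toℕ j)) (block j)) →
    (∀ j → B (toℕ j) ∪ Dominated (block j) ⊆ B (suc (toℕ j))) →
    LegalAfter (B 0) (concat (tabulate block))
  LegalAfter-concat {q = zero} _ _ _ _ = tt
  LegalAfter-concat {q = suc q} B block legal grows =
    LegalAfter-++ (block fzero) _ (legal fzero)
      (LegalAfter-antitone _ (grows fzero)
        (LegalAfter-concat (B ∘ suc) (block ∘ fsuc) (legal ∘ fsuc) (λ j → grows (fsuc j))))

  LegalAfter-footprint : ∀ {n} {D : Pred (Vertex n) 0ℓ} s → LegalAfter D s → ∀ i →
    ∃ λ w → w ∈ N[ List.lookup s i ] ∩ ∁ D ×
            (∀ j → toℕ j < toℕ i → w ∉ N[ List.lookup s j ])
  LegalAfter-footprint (v ∷ s) ((w , fp) , _) fzero = w , fp , λ _ ()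
  LegalAfter-footprint (v ∷ s) (_ , rest) (fsuc i) with LegalAfter-footprint s rest i
  ... | w , (w∈N , w∉D∪Nv) , fresh = w , (w∈N , w∉D∪Nv ∘ inj₁) , earlier
    where
    earlier : ∀ j → toℕ j < suc (toℕ i) → w ∉ N[ List.lookup (v ∷ s) j ]
    earlier fzero _ = w∉D∪Nv ∘ inj₂
    earlier (fsuc j) (s≤s j<i) = fresh j j<i

  LegalAfter-excludes : ∀ {n} {D : Pred (Vertex n) 0ℓ} {v} s → LegalAfter D s →
                        N[ v ] ⊆ D → All (v ≢_) s
  LegalAfter-excludes [] _ _ = []
  LegalAfter-excludes (x ∷ s) ((w , w∈N , w∉D) , rest) Nv⊆D =
    (λ { refl → w∉D (Nv⊆D w∈N) }) ∷ LegalAfter-excludes s rest (inj₁ ∘ Nv⊆D)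

  LegalAfter-unique : ∀ {n} {D : Pred (Vertex n) 0ℓ} s → LegalAfter D s → AllPairs _≢_ s
  LegalAfter-unique [] _ = []
  LegalAfter-unique (v ∷ s) (_ , rest) = LegalAfter-excludes s rest inj₂ ∷ LegalAfter-unique s rest

  LegalAfter⇒Legal : ∀ {n} {D : Pred (Vertex n) 0ℓ} s → LegalAfter D s → Legal p n s
  LegalAfter⇒Legal s legal =
    LegalAfter-unique s legal ,
    λ i → let w , (w∈N , _) , fresh = LegalAfter-footprint s legal i in w , w∈N , fresh

  record CliqueCover (n k : ℕ) : Set₁ where
    field
      Clique : Set
      _∈ᶜ_ : Vertex n → Clique → Set
      ∈ᶜ⇒∈N : ∀ {c v w} → v ∈ᶜ c → w ∈ᶜ c → w ∈ N[ v ]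
      ∈N⇒∈ᶜ : ∀ {v w} → w ∈ N[ v ] → ∃ λ c → v ∈ᶜ c × w ∈ᶜ c
      index : Clique ↣ Fin k

  Legal-length≤ : ∀ {n k} → CliqueCover n k → ∀ {s} → Legal p n s → length s ≤ k
  Legal-length≤ cover {s} (_ , footprint) = Fin.injective⇒≤ injective
    where
    open CliqueCover cover
    pairClique : ∀ i → ∃ λ c → List.lookup s i ∈ᶜ c × proj₁ (footprint i) ∈ᶜ c
    pairClique i = ∈N⇒∈ᶜ (proj₁ (proj₂ (footprint i)))
    clique : Fin (length s) → Clique
    clique i = proj₁ (pairClique i)
    earlier-not-shared : ∀ {i j} → toℕ i < toℕ j → clique i ≢ clique j
    earlier-not-shared {i} {j} i<j same =
      proj₂ (proj₂ (footprint j)) i i<j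
        (∈ᶜ⇒∈N (proj₁ (proj₂ (pairClique i)))
               (subst (_ ∈ᶜ_) (sym same) (proj₂ (proj₂ (pairClique j)))))
    injective : ∀ {i j} → Injection.to index (clique i) ≡ Injection.to index (clique j) → i ≡ j
    injective {i} {j} same with Fin.<-cmp i j
    ... | tri< i<j _ _ = ⊥-elim (earlier-not-shared i<j (Injection.injective index same))
    ... | tri≈ _ i≡j _ = i≡j
    ... | tri> _ _ j<i = ⊥-elim (earlier-not-shared j<i (sym (Injection.injective index same)))

  Clique : ℕ → Set
  Clique zero = ⊤
  Clique (suc m) = (Fin p × Clique m) ⊎ Bridge p

  _∈ᶜ_ : ∀ {m} → Vertex (suc m) → Clique m → Set
  _∈ᶜ_ {zero} _ _ = ⊤
  _∈ᶜ_ {suc m} v (inj₁ (a , c)) = head v ≡ a × tail v ∈ᶜ c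
  _∈ᶜ_ {suc m} v (inj₂ (j , k , _)) = v ≡ j ∷ extreme (suc m) k ⊎ v ≡ k ∷ extreme (suc m) j

  ∈ᶜ⇒∈N : ∀ {m} (c : Clique m) {v w} → v ∈ᶜ c → w ∈ᶜ c → w ∈ N[ v ]
  ∈ᶜ⇒∈N {zero} _ {a ∷ []} {b ∷ []} _ _ = ∈N-complete a b
  ∈ᶜ⇒∈N {suc m} (inj₁ (a , c)) {.a ∷ _} {.a ∷ _} (refl , v∈c) (refl , w∈c) =
    ∈N-∷⁺ a (∈ᶜ⇒∈N c v∈c w∈c)
  ∈ᶜ⇒∈N {suc m} (inj₂ (j , k , j<k)) (inj₁ refl) (inj₁ refl) = inj₁ refl
  ∈ᶜ⇒∈N {suc m} (inj₂ (j , k , j<k)) (inj₁ refl) (inj₂ refl) = ∈N-bridge⁺ (Fin.<⇒≢ j<k)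
  ∈ᶜ⇒∈N {suc m} (inj₂ (j , k , j<k)) (inj₂ refl) (inj₁ refl) = ∈N-bridge⁺ (Fin.<⇒≢ j<k ∘ sym)
  ∈ᶜ⇒∈N {suc m} (inj₂ (j , k , j<k)) (inj₂ refl) (inj₂ refl) = inj₁ refl

  ∈N⇒∈ᶜ : ∀ {m} {v w : Vertex (suc m)} → w ∈ N[ v ] → ∃ λ c → v ∈ᶜ c × w ∈ᶜ c
  ∈N⇒∈ᶜ {zero} _ = tt , tt , tt
  ∈N⇒∈ᶜ {suc m} {a ∷ v} {b ∷ w} w∈N with a Fin.≟ b
  ... | yes refl =
    let c , v∈c , w∈c = ∈N⇒∈ᶜ (∈N-∷⁻ w∈N) in inj₁ (a , c) , (refl , v∈c) , (refl , w∈c)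
  ... | no a≢b with ∈N-bridge⁻ a≢b w∈N | Fin.<-cmp a b
  ...   | refl , refl | tri< a<b _ _ = inj₂ (a , b , a<b) , inj₁ refl , inj₂ refl
  ...   | _ | tri≈ _ a≡b _ = ⊥-elim (a≢b a≡b)
  ...   | refl , refl | tri> _ _ b<a = inj₂ (b , a , b<a) , inj₂ refl , inj₁ refl

  Clique↣ : ∀ m → Clique m ↣ Fin (cliques p m)
  Clique↣ zero = mk↣ {to = λ _ → fzero} λ _ → refl
  Clique↣ (suc m) =
    ↔⇒↣ (↔-sym Fin.+↔⊎) ↣-∘
      ((↔⇒↣ (↔-sym Fin.*↔×) ↣-∘ (↣-id _ ×-↣ Clique↣ m)) ⊎-↣ bridge↣ p)

  sierpinskiCover : ∀ m → CliqueCover (suc m) (cliques p m)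
  sierpinskiCover m = record
    { Clique = Clique m
    ; _∈ᶜ_ = _∈ᶜ_
    ; ∈ᶜ⇒∈N = λ {c} → ∈ᶜ⇒∈N c
    ; ∈N⇒∈ᶜ = ∈N⇒∈ᶜ
    ; index = Clique↣ m
    }

  Predominated : ∀ n → ℕ → Pred (Vertex n) 0ℓ
  Predominated n d w = ∃ λ e → w ≡ extreme n e × toℕ e < d

  Reserved : ∀ n → ℕ → Pred (Vertex n) 0ℓ
  Reserved n x w = ∃ λ e → w ≡ extreme n e × x ≤ toℕ e

  -- A sequence for a copy of S_p^(m+1) inside a larger graph, whose extreme vertices
  -- e^(m+1) with e < d are dominated from outside and those with x ≤ e are used outside.
  record GoodSequence (m d x : ℕ) : Set where
    field
      seq : List (Vertex (suc m))
      legal : LegalAfter (Predominated (suc m) d) seq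
      avoids : All (∁ (Reserved (suc m) x)) seq
      length≡ : length seq ≡ cliques p m

  goodSequence₀ : ∀ {d x} (a b : Fin p) → toℕ a < x → d ≤ toℕ b → GoodSequence 0 d x
  goodSequence₀ a b a<x d≤b = record
    { seq = [ a ∷ [] ]
    ; legal = (b ∷ [] , ∈N-complete a b , λ { (_ , refl , b<d) → ℕ.<⇒≱ b<d d≤b }) , tt
    ; avoids = (λ { (_ , refl , x≤a) → ℕ.<⇒≱ a<x x≤a }) ∷ []
    ; length≡ = refl
    }

  module Blocks (m : ℕ) (good : ∀ {d x} → 0 < x → d < p → GoodSequence m d x)
                {d x : ℕ} (0<x : 0 < x) (d<p : d < p) where

    -- In the copy with first letter j the extreme letters e < j and e > j are ends of
    -- earlier and later bridges; only e = j, an extreme vertex of the whole graph,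
    -- takes its status from d and x.
    copy : (j : Fin p) → GoodSequence m (clamp (toℕ j) d) (clamp (toℕ j) x)
    copy j = good (clamp-positive (toℕ j) 0<x) (clamp-< (Fin.toℕ<n j) d<p)

    copyVertices bridgeVertices block : Fin p → List (Vertex (suc (suc m)))
    copyVertices j = map (j ∷_) (GoodSequence.seq (copy j))
    bridgeVertices j = map (λ k → j ∷ extreme (suc m) k) (greaterThan j)
    block j = copyVertices j ++ bridgeVertices j

    -- Everything the blocks of the letters below J can dominate: their copies and the
    -- far ends of their bridges.
    Before : ℕ → Pred (Vertex (suc (suc m))) 0ℓ
    Before J w = toℕ (head w) < J ⊎ ∃ λ e → tail w ≡ extreme (suc m) e × toℕ e < J

    DominatedBefore : ℕ → Pred (Vertex (suc (suc m))) 0ℓ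
    DominatedBefore J = Before J ∪ Predominated (suc (suc m)) d

    copy-legal : ∀ j → LegalAfter (DominatedBefore (toℕ j)) (copyVertices j)
    copy-legal j = LegalAfter-map-∷ j _ entering (GoodSequence.legal (copy j))
      where
      entering : ∀ {u} → j ∷ u ∈ DominatedBefore (toℕ j) →
                 u ∈ Predominated (suc m) (clamp (toℕ j) d)
      entering (inj₁ (inj₁ j<j)) = ⊥-elim (ℕ.<-irrefl refl j<j)
      entering (inj₁ (inj₂ (e , u≡e , e<j))) = e , u≡e , ℕ.<-≤-trans e<j (clamp-≥ _ _)
      entering (inj₂ (_ , refl , j<d)) = j , refl , <⇒<clamp j<d

    bridges-legal : ∀ j → LegalAfter (DominatedBefore (toℕ j) ∪ Dominated (copyVertices j))
                                     (bridgeVertices j)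
    bridges-legal j =
      LegalAfter-footprints (λ k → j ∷ extreme (suc m) k) (λ k → k ∷ extreme (suc m) j)
        (All.map fresh (greaterThan-above j)) (AllPairs.map separate (greaterThan-distinct j))
      where
      fresh : ∀ {k} → toℕ j < toℕ k → k ∷ extreme (suc m) j ∈
              N[ j ∷ extreme (suc m) k ] ∩ ∁ (DominatedBefore (toℕ j) ∪ Dominated (copyVertices j))
      fresh {k} j<k = ∈N-bridge⁺ (Fin.<⇒≢ j<k) , λ where
        (inj₁ (inj₁ (inj₁ k<j))) → ℕ.<-asym j<k k<j
        (inj₁ (inj₁ (inj₂ (e , j≡e , e<j)))) →
          ℕ.<-irrefl (cong toℕ (sym (extreme-injective j≡e))) e<j
        (inj₁ (inj₂ (e , kj≡e , _))) →
          Fin.<⇒≢ j<k (trans (extreme-injective (cong tail kj≡e)) (sym (cong head kj≡e)))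
        (inj₂ dominated) → All.lookupWith
          (λ u∉R kj∈N →
            u∉R (k , proj₁ (∈N-bridge⁻ (Fin.<⇒≢ j<k) kj∈N) , ℕ.≤-trans (clamp-≤ _ _) j<k))
          (GoodSequence.avoids (copy j)) (Any.map⁻ dominated)
      separate : ∀ {k k′} → k ≢ k′ × toℕ j < toℕ k′ →
                 k′ ∷ extreme (suc m) j ∉ N[ j ∷ extreme (suc m) k ]
      separate (k≢k′ , j<k′) k′j∈N =
        k≢k′ (extreme-injective (proj₁ (∈N-bridge⁻ (Fin.<⇒≢ j<k′) k′j∈N)))

    block-heads : ∀ j → All (λ v → head v ≡ j) (block j)
    block-heads j = All.++⁺ (All.map⁺ (All.universal (λ _ → refl) (GoodSequence.seq (copy j))))
                            (All.map⁺ (All.universal (λ _ → refl) (greaterThan j)))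

    ∈N⇒Before : ∀ {v w : Vertex (suc (suc m))} → w ∈ N[ v ] → w ∈ Before (suc (toℕ (head v)))
    ∈N⇒Before {v} {w} w∈N with ∈N-head w w∈N
    ... | inj₁ same-head = inj₁ (ℕ.≤-reflexive (cong (suc ∘ toℕ) same-head))
    ... | inj₂ tail≡ = inj₂ (head v , tail≡ , ℕ.n<1+n _)

    grows : ∀ j → DominatedBefore (toℕ j) ∪ Dominated (block j) ⊆ DominatedBefore (suc (toℕ j))
    grows j (inj₁ (inj₁ (inj₁ h<j))) = inj₁ (inj₁ (ℕ.m<n⇒m<1+n h<j))
    grows j (inj₁ (inj₁ (inj₂ (e , t≡e , e<j)))) = inj₁ (inj₂ (e , t≡e , ℕ.m<n⇒m<1+n e<j))
    grows j (inj₁ (inj₂ predominated)) = inj₂ predominated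
    grows j {w} (inj₂ dominated) = inj₁ (All.lookupWith
      (λ head≡j w∈N → subst (λ a → w ∈ Before (suc (toℕ a))) head≡j (∈N⇒Before w∈N))
      (block-heads j) dominated)

    avoids : ∀ j → All (∁ (Reserved (suc (suc m)) x)) (block j)
    avoids j = All.++⁺ (All.map⁺ (All.map lift (GoodSequence.avoids (copy j))))
                       (All.map⁺ (All.map bridge-avoids (greaterThan-above j)))
      where
      lift : ∀ {u} → u ∉ Reserved (suc m) (clamp (toℕ j) x) → j ∷ u ∉ Reserved (suc (suc m)) x
      lift u∉R (_ , refl , x≤j) = u∉R (j , refl , clamp-≤-self x≤j)
      bridge-avoids : ∀ {k} → toℕ j < toℕ k → j ∷ extreme (suc m) k ∉ Reserved (suc (suc m)) x
      bridge-avoids j<k (e , jk≡e , _) =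
        Fin.<⇒≢ j<k (trans (cong head jk≡e) (sym (extreme-injective (cong tail jk≡e))))

    block-legal : ∀ j → LegalAfter (DominatedBefore (toℕ j)) (block j)
    block-legal j = LegalAfter-++ (copyVertices j) _ (copy-legal j) (bridges-legal j)

    goodSequence : GoodSequence (suc m) d x
    goodSequence = record
      { seq = concat (tabulate block)
      ; legal = LegalAfter-antitone _ inj₂ (LegalAfter-concat DominatedBefore block block-legal grows)
      ; avoids = All.concat⁺ (All.tabulate⁺ avoids)
      ; length≡ = length-concat-blocks (cliques p m) block λ j →
          trans (List.length-++ (copyVertices j))
                (cong₂ _+_ (trans (List.length-map _ (GoodSequence.seq (copy j)))
                                  (GoodSequence.length≡ (copy j)))
                           (List.length-map _ (greaterThan j)))
      }

  goodSequence : ∀ m {d x} → 0 < x → d < p → GoodSequence m d x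
  goodSequence zero 0<x d<p =
    goodSequence₀ (fromℕ< (ℕ.≤-<-trans z≤n d<p)) (fromℕ< d<p)
      (subst (_< _) (sym (Fin.toℕ-fromℕ< _)) 0<x) (ℕ.≤-reflexive (sym (Fin.toℕ-fromℕ< d<p)))
  goodSequence (suc m) = Blocks.goodSequence m (goodSequence m)

  maximal⇒Dominating : ∀ {n} s → LegalAfter ∅ s → (∀ t → Legal p n t → length t ≤ length s) →
                       Dominating p n s
  maximal⇒Dominating s legal maximal w with any? (λ v → ∈N? v w) s
  ... | yes dominated = dominated
  ... | no undominated = ⊥-elim (ℕ.<-irrefl refl (subst (_≤ length s) length-extended
                                  (maximal _ (LegalAfter⇒Legal _ legal-extended))))
    where
    legal-extended : LegalAfter ∅ (s ++ [ w ])
    legal-extended = LegalAfter-++ s [ w ] legal ((w , inj₁ refl , Sum.[ (λ ()) , undominated ]) , tt)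
    length-extended : length (s ++ [ w ]) ≡ suc (length s)
    length-extended = trans (List.length-++ s) (ℕ.+-comm (length s) 1)

  γgr≡cliques : ∀ m → 0 < p → IsGrundyDominationNumber p (suc m) (cliques p m)
  γgr≡cliques m 0<p = (seq , (LegalAfter⇒Legal seq legal∅ , dominating) , length≡) , bounded
    where
    open GoodSequence (goodSequence m {0} {1} (s≤s z≤n) 0<p)
    legal∅ : LegalAfter ∅ seq
    legal∅ = LegalAfter-antitone seq (λ ()) legal
    bound : ∀ t → Legal p (suc m) t → length t ≤ cliques p m
    bound t = Legal-length≤ (sierpinskiCover m)
    dominating : Dominating p (suc m) seq
    dominating =
      maximal⇒Dominating seq legal∅ (λ t → subst (length t ≤_) (sym length≡) ∘ bound t)
    bounded : ∀ t → LegalDominating p (suc m) t → length t ≤ cliques p m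
    bounded t = bound t ∘ proj₁

bridges : ℕ → ℕ → ℕ
bridges p zero = 0
bridges p (suc m) = p * bridges p m + pairs p

cliques≡ : ∀ p m → cliques p m ≡ p ^ m + bridges p m
cliques≡ p zero = refl
cliques≡ p (suc m) = begin
  p * cliques p m + pairs p             ≡⟨ cong (λ c → p * c + pairs p) (cliques≡ p m) ⟩
  p * (p ^ m + bridges p m) + pairs p   ≡⟨ distribute p (p ^ m) (bridges p m) (pairs p) ⟩
  p * p ^ m + (p * bridges p m + pairs p) ∎
  where
  open ≡-Reasoning
  distribute : ∀ p x y z → p * (x + y) + z ≡ p * x + (p * y + z)
  distribute = solve-∀

pairs-double : ∀ q → pairs q * 2 + q ≡ q * q
pairs-double zero = refl
pairs-double (suc q) = begin
  (q + pairs q) * 2 + suc q        ≡⟨ regroup q (pairs q) ⟩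
  (pairs q * 2 + q) + suc (q * 2)  ≡⟨ cong (_+ suc (q * 2)) (pairs-double q) ⟩
  q * q + suc (q * 2)              ≡⟨ square q ⟩
  suc q * suc q                    ∎
  where
  open ≡-Reasoning
  regroup : ∀ q r → (q + r) * 2 + suc q ≡ (r * 2 + q) + suc (q * 2)
  regroup = solve-∀
  square : ∀ q → q * q + suc (q * 2) ≡ suc q * suc q
  square = solve-∀

bridges-double : ∀ p m → bridges p m * 2 + p ≡ p * p ^ m
bridges-double p zero = sym (ℕ.*-identityʳ p)
bridges-double p (suc m) = begin
  (p * bridges p m + pairs p) * 2 + p    ≡⟨ regroup p (bridges p m) (pairs p) ⟩
  p * (bridges p m * 2) + (pairs p * 2 + p) ≡⟨ cong (p * (bridges p m * 2) +_) (pairs-double p) ⟩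
  p * (bridges p m * 2) + p * p          ≡⟨ ℕ.*-distribˡ-+ p (bridges p m * 2) p ⟨
  p * (bridges p m * 2 + p)              ≡⟨ cong (p *_) (bridges-double p m) ⟩
  p * (p * p ^ m)                        ∎
  where
  open ≡-Reasoning
  regroup : ∀ p b r → (p * b + r) * 2 + p ≡ p * (b * 2) + (r * 2 + p)
  regroup = solve-∀

cliques-closed : ∀ p m → cliques p m ≡ p ^ m + p * (p ^ m ∸ 1) / 2
cliques-closed p m = trans (cliques≡ p m) (cong (p ^ m +_) (sym half))
  where
  open ≡-Reasoning
  half : p * (p ^ m ∸ 1) / 2 ≡ bridges p m
  half = begin
    p * (p ^ m ∸ 1) / 2               ≡⟨ cong (_/ 2) (ℕ.*-distribˡ-∸ p (p ^ m) 1) ⟩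
    (p * p ^ m ∸ p * 1) / 2
      ≡⟨ cong₂ (λ a b → (a ∸ b) / 2) (sym (bridges-double p m)) (ℕ.*-identityʳ p) ⟩
    (bridges p m * 2 + p ∸ p) / 2     ≡⟨ cong (_/ 2) (ℕ.m+n∸n≡m (bridges p m * 2) p) ⟩
    bridges p m * 2 / 2               ≡⟨ DivMod.m*n/n≡m (bridges p m) 2 ⟩
    bridges p m                       ∎

theorem3p1 : (n p : ℕ) → 1 ≤ n → 1 ≤ p →
    IsGrundyDominationNumber p n (p ^ (n ∸ 1) + (p * (p ^ (n ∸ 1) ∸ 1)) / 2)
theorem3p1 (suc m) p _ 0<p =
  subst (IsGrundyDominationNumber p (suc m)) (cliques-closed p m) (γgr≡cliques m 0<p)
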